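{- Let $s,k,d$ be positive integers with $s,k$ coprime, $s\ge2$, and $d<k$. Let $\overline{s}=s\bmod k$ and $\widetilde{s}=\min\{\ell\cdot(\overline{s})^{ -1}\bmod k \mid -d\le\ell\le d,\ \ell\ne0\}$, where $(\overline{s})^{ -1}$ is the inverse of $\overline{s}$ modulo $k$. For $i\in\mathbb{Z}/k\mathbb{Z}$ let $I_i=(i,\,i+\overline{s},\,\dots,\,i+\overline{s}(\widetilde{s}-1))$, a tuple of elements of $\mathbb{Z}/k\mathbb{Z}$, and suppose $I_i$ does not contain both $0$ and $\overline{s}$. Then \[ |I_i\cap[\overline{s}-1]|=\begin{cases} \left\lceil\frac{\overline{s}\widetilde{s}}{k}\right\rceil &\text{if } i\in(\overline{s}-\overline{s}\widetilde{s},\,\overline{s})_k,\\ \left\lceil\frac{\overline{s}\widetilde{s}}{k}\right\rceil-1 &\text{if } i\in[\overline{s},\,\overline{s}-\overline{s}\widetilde{s}]_k. \end{cases} \] In particular, \[ \max_I |I\cap[\overline{s}-1]|=\left\lceil\frac{\overline{s}\widetilde{s}-1}{k}\right\rceil, \] where the maximum is over all tuples $I=I_j$ ($j\in\mathbb{Z}/k\mathbb{Z}$) not containing both $0$ and $\overline{s}$.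
   Context: $[\overline{s}-1]=\{1,2,\dots,\overline{s}-1\}$, regarded as a subset of $\mathbb{Z}/k\mathbb{Z}$; $|I\cap A|$ is the number of entries of the tuple $I$ lying in $A$. For $a,b\in\mathbb{Z}$ (or residues mod $k$), the wrapped interval $(a,b)_k$ is $(a\bmod k,\,b\bmod k)$ (integers strictly between) if $a\bmod k\le b\bmod k$, and $(a\bmod k,\,k-1]\cup[0,\,b\bmod k)$ if $a\bmod k>b\bmod k$; closed and half-open versions such as $[a,b]_k$ are defined analogously, with intervals taken in $\{0,\dots,k-1\}$ identified with $\mathbb{Z}/k\mathbb{Z}$. -}

module Defs where

open import Data.Nat using (ℕ; zero; suc; _+_; _*_; _∸_; _≤_; _<_; _⊓_; NonZero; _≤?_; _<?_)
open import Data.Nat.DivMod using (_%_; _/_)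
open import Data.Integer as ℤ using (ℤ; +_; -[1+_]; _%ℕ_)
open import Data.List using (List; map; upTo; foldr; _++_; length; filter)
open import Data.List.Membership.Propositional using (_∈_)
open import Data.Product using (_×_)
open import Data.Sum using (_⊎_)
open import Relation.Nullary using (¬_)
open import Relation.Nullary.Decidable using (_×-dec_)

sbar : (s k : ℕ) .{{_ : NonZero k}} → ℕ
sbar s k = s % k

nonzeroRange : ℕ → List ℤ
nonzeroRange d = map (λ n → + suc n) (upTo d) ++ map (λ n → -[1+ n ]) (upTo d)

-- s̃ = min { ℓ · u mod k | -d ≤ ℓ ≤ d, ℓ ≠ 0 }, where u is the inverse of s̄ mod k.
-- The minimum of a list of residues (all < k) is computed as a fold of _⊓_
-- starting from k; for d ≥ 1 the list is nonempty, so this is the true minimum.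
stilde : (k u d : ℕ) .{{_ : NonZero k}} → ℕ
stilde k u d = foldr _⊓_ k (map (λ ℓ → (ℓ ℤ.* + u) %ℕ k) (nonzeroRange d))

tupleI : (k sb st i : ℕ) .{{_ : NonZero k}} → List ℕ
tupleI k sb st i = map (λ j → (i + sb * j) % k) (upTo st)

countIn : (sb : ℕ) → List ℕ → ℕ
countIn sb I = length (filter (λ x → (1 ≤? x) ×-dec (x <? sb)) I)

admissible : (sb : ℕ) → List ℕ → Set
admissible sb I = ¬ ((0 ∈ I) × (sb ∈ I))

ceilDiv : (a k : ℕ) .{{_ : NonZero k}} → ℕ
ceilDiv a k = (a + (k ∸ 1)) / k

inOpen : (k : ℕ) .{{_ : NonZero k}} → ℤ → ℤ → ℕ → Set
inOpen k a b i =
  let a' = a %ℕ k ; b' = b %ℕ k in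
  (a' ≤ b' × (a' < i × i < b')) ⊎ (b' < a' × (a' < i ⊎ i < b'))

inClosed : (k : ℕ) .{{_ : NonZero k}} → ℤ → ℤ → ℕ → Set
inClosed k a b i =
  let a' = a %ℕ k ; b' = b %ℕ k in
  (a' ≤ b' × (a' ≤ i × i ≤ b')) ⊎ (b' < a' × (a' ≤ i ⊎ i ≤ b'))

{-# OPTIONS --safe #-}
-- Along the unreduced orbit y_j = i + j s̄, an entry y mod k lies in [1, s̄ − 1] exactly when
-- ⌊(y + k − 1)/k⌋ − ⌊(y + k − s̄)/k⌋ = 1.  Admissibility means that no entry 0 is followed by s̄,
-- so ⌊(y_j + k − 1)/k⌋ = ⌊(y_{j+1} + k − s̄)/k⌋ for every entry but the last, and the count
-- telescopes to ⌊(rot i + s̄s̃ − 1)/k⌋ with rot i = (i − s̄) mod k.  Writing s̄s̃ − 1 = qk + b, this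
-- is q plus the carry of rot i + b; since rot (s̄ − s̄s̃) + b + 1 = k, the carry occurs exactly on
-- the arc (s̄ − s̄s̃, s̄)_k.  The maximum ⌈(s̄s̃ − 1)/k⌉ is reached at rot i = k − 1, i.e. i = s̄ − 1,
-- whose tuple could contain s̄ only at an index j ≡ s̄⁻¹, and s̃ ≤ s̄⁻¹ mod k.
module Submission where

open import Defs
open import Data.Nat using (ℕ; zero; suc; _+_; _*_; _∸_; _≤_; _<_; NonZero; z≤n; s≤s; _≤?_; _<?_)
open import Data.Nat.Properties
open import Data.Nat.DivMod
open import Data.Nat.Divisibility using (divides)
open import Data.Nat.Coprimality using (Coprime)
open import Data.Nat.Tactic.RingSolver using (solve-∀)
open import Data.Integer as ℤ using (ℤ; +_; -[1+_]; _%ℕ_)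
open import Data.Integer.DivMod using (n%ℕd<d)
import Data.Integer.Properties as ℤ
open import Data.List using (List; []; _∷_; [_]; applyUpTo; filter; length)
open import Data.List.Properties using (map-upTo; filter-accept; filter-reject; filter-++; length-++)
open import Data.List.Relation.Unary.Any using (here; there)
open import Data.List.Membership.Propositional.Properties using (∈-map⁻; ∈-upTo⁻)
open import Data.Product using (_×_; _,_; proj₂; ∃-syntax)
open import Data.Sum using (inj₁; inj₂)
open import Data.Empty using (⊥-elim)
open import Relation.Nullary using (Dec; yes; no)
open import Relation.Nullary.Decidable using (_×-dec_)
open import Relation.Binary.PropositionalEquality
  using (_≡_; _≢_; refl; sym; trans; cong; cong₂; subst; subst₂; module ≡-Reasoning)

module _ (k : ℕ) .{{_ : NonZero k}} where

  /-split : ∀ m n → (m + n) / k ≡ m / k + (m % k + n) / k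
  /-split m n = begin
    (m + n) / k                           ≡⟨ /-congˡ (cong (_+ n) (m≡m%n+[m/n]*n m k)) ⟩
    (m % k + m / k * k + n) / k           ≡⟨ /-congˡ (shuffle (m % k) (m / k * k) n) ⟩
    (m % k + n + m / k * k) / k           ≡⟨ +-distrib-/-∣ʳ (m % k + n) (divides (m / k) refl) ⟩
    (m % k + n) / k + m / k * k / k       ≡⟨ cong (λ x → (m % k + n) / k + x) (m*n/n≡m (m / k) k) ⟩
    (m % k + n) / k + m / k               ≡⟨ +-comm _ (m / k) ⟩
    m / k + (m % k + n) / k               ∎
    where
    open ≡-Reasoning
    shuffle : ∀ a b c → a + b + c ≡ a + c + b
    shuffle = solve-∀

  k≤m<2k⇒m/k≡1 : ∀ {m} → k ≤ m → m < k + k → m / k ≡ 1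
  k≤m<2k⇒m/k≡1 {m} k≤m m<2k = trans (m/n≡1+[m∸n]/n k≤m) (cong suc (m<n⇒m/n≡0 (m<n+o⇒m∸n<o m k m<2k)))

  [m%k+n]%k≡[m+n]%k : ∀ m n → (m % k + n) % k ≡ (m + n) % k
  [m%k+n]%k≡[m+n]%k m n = begin
    (m % k + n) % k           ≡⟨ %-distribˡ-+ (m % k) n k ⟩
    (m % k % k + n % k) % k   ≡⟨ cong (λ x → (x + n % k) % k) (m%n%n≡m%n m k) ⟩
    (m % k + n % k) % k       ≡⟨ %-distribˡ-+ m n k ⟨
    (m + n) % k               ∎
    where open ≡-Reasoning

  [m+n%k]%k≡[m+n]%k : ∀ m n → (m + n % k) % k ≡ (m + n) % k
  [m+n%k]%k≡[m+n]%k m n = begin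
    (m + n % k) % k   ≡⟨ %-congˡ (+-comm m (n % k)) ⟩
    (n % k + m) % k   ≡⟨ [m%k+n]%k≡[m+n]%k n m ⟩
    (n + m) % k       ≡⟨ %-congˡ (+-comm n m) ⟩
    (m + n) % k       ∎
    where open ≡-Reasoning

  [m*[n%k]]%k≡[m*n]%k : ∀ m n → (m * (n % k)) % k ≡ (m * n) % k
  [m*[n%k]]%k≡[m*n]%k m n = begin
    (m * (n % k)) % k           ≡⟨ %-distribˡ-* m (n % k) k ⟩
    (m % k * (n % k % k)) % k   ≡⟨ cong (λ x → (m % k * x) % k) (m%n%n≡m%n n k) ⟩
    (m % k * (n % k)) % k       ≡⟨ %-distribˡ-* m n k ⟨
    (m * n) % k                 ∎
    where open ≡-Reasoning

  %-cancelˡ-+ : ∀ a m n → (a + m) % k ≡ (a + n) % k → m % k ≡ n % k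
  %-cancelˡ-+ a m n eq = trans (sym (subtract a m)) (trans (cong (λ x → (k ∸ a % k + x) % k) eq) (subtract a n))
    where
    subtract : ∀ a m → (k ∸ a % k + (a + m) % k) % k ≡ m % k
    subtract a m = begin
      (k ∸ a % k + (a + m) % k) % k     ≡⟨ cong (λ x → (k ∸ a % k + x) % k) ([m%k+n]%k≡[m+n]%k a m) ⟨
      (k ∸ a % k + (a % k + m) % k) % k ≡⟨ [m+n%k]%k≡[m+n]%k (k ∸ a % k) (a % k + m) ⟩
      (k ∸ a % k + (a % k + m)) % k     ≡⟨ %-congˡ (+-assoc (k ∸ a % k) (a % k) m) ⟨
      (k ∸ a % k + a % k + m) % k       ≡⟨ %-congˡ (cong (_+ m) (m∸n+n≡m (m%n≤n a k))) ⟩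
      (k + m) % k                       ≡⟨ %-congˡ (+-comm k m) ⟩
      (m + k) % k                       ≡⟨ [m+n]%n≡m%n m k ⟩
      m % k                             ∎
      where open ≡-Reasoning

  %-inverse-unique : ∀ x u v → (x * u) % k ≡ 1 % k → (x * v) % k ≡ 1 % k → u % k ≡ v % k
  %-inverse-unique x u v xu≡1 xv≡1 = begin
    u % k               ≡⟨ absorb u v xv≡1 ⟩
    (u * (x * v)) % k   ≡⟨ %-congˡ (swap u x v) ⟩
    (v * (x * u)) % k   ≡⟨ absorb v u xu≡1 ⟨
    v % k               ∎
    where
    open ≡-Reasoning
    swap : ∀ u x v → u * (x * v) ≡ v * (x * u)
    swap = solve-∀
    absorb : ∀ u v → (x * v) % k ≡ 1 % k → u % k ≡ (u * (x * v)) % k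
    absorb u v xv≡1 = begin
      u % k                   ≡⟨ %-congˡ (*-identityʳ u) ⟨
      (u * 1) % k             ≡⟨ [m*[n%k]]%k≡[m*n]%k u 1 ⟨
      (u * (1 % k)) % k       ≡⟨ cong (λ y → (u * y) % k) xv≡1 ⟨
      (u * ((x * v) % k)) % k ≡⟨ [m*[n%k]]%k≡[m*n]%k u (x * v) ⟩
      (u * (x * v)) % k       ∎

  -[1+w]%ℕk+[1+w]%k≡0 : ∀ w → (-[1+ w ] %ℕ k + suc w) % k ≡ 0
  -[1+w]%ℕk+[1+w]%k≡0 w with suc w % k in eq
  ... | zero  = eq
  ... | suc t = begin
    (k ∸ suc t + suc w) % k       ≡⟨ [m+n%k]%k≡[m+n]%k (k ∸ suc t) (suc w) ⟨
    (k ∸ suc t + suc w % k) % k   ≡⟨ cong (λ x → (k ∸ suc t + x) % k) eq ⟩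
    (k ∸ suc t + suc t) % k       ≡⟨ %-congˡ (m∸n+n≡m (subst (_≤ k) eq (m%n≤n (suc w) k))) ⟩
    k % k                         ≡⟨ n%n≡0 k ⟩
    0                             ∎
    where open ≡-Reasoning

  [[m-n]%ℕk+n]%k≡m%k : ∀ m n → ((+ m ℤ.- + n) %ℕ k + n) % k ≡ m % k
  [[m-n]%ℕk+n]%k≡m%k m n with n ≤? m
  ... | yes n≤m = begin
    ((+ m ℤ.- + n) %ℕ k + n) % k   ≡⟨ cong (λ z → (z %ℕ k + n) % k) (trans (ℤ.[+m]-[+n]≡m⊖n m n) (ℤ.⊖-≥ n≤m)) ⟩
    ((m ∸ n) % k + n) % k          ≡⟨ [m%k+n]%k≡[m+n]%k (m ∸ n) n ⟩
    (m ∸ n + n) % k                ≡⟨ %-congˡ (m∸n+n≡m n≤m) ⟩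
    m % k                          ∎
    where open ≡-Reasoning
  ... | no n≰m with m≤n⇒∃[o]m+o≡n (≰⇒> n≰m)
  ...   | w , refl = begin
    ((+ m ℤ.- + (suc m + w)) %ℕ k + (suc m + w)) % k ≡⟨ cong (λ z → (z %ℕ k + (suc m + w)) % k) m-n≡-[1+w] ⟩
    (-[1+ w ] %ℕ k + (suc m + w)) % k      ≡⟨ %-congˡ (shuffle (-[1+ w ] %ℕ k) m w) ⟩
    (m + (-[1+ w ] %ℕ k + suc w)) % k      ≡⟨ [m+n%k]%k≡[m+n]%k m _ ⟨
    (m + (-[1+ w ] %ℕ k + suc w) % k) % k  ≡⟨ cong (λ x → (m + x) % k) (-[1+w]%ℕk+[1+w]%k≡0 w) ⟩
    (m + 0) % k                            ≡⟨ %-congˡ (+-identityʳ m) ⟩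
    m % k                                  ∎
    where
    open ≡-Reasoning
    shuffle : ∀ l m w → l + (suc m + w) ≡ m + (l + suc w)
    shuffle = solve-∀
    m-n≡-[1+w] : + m ℤ.- + (suc m + w) ≡ -[1+ w ]
    m-n≡-[1+w] = begin
      + m ℤ.- + (suc m + w)      ≡⟨ ℤ.[+m]-[+n]≡m⊖n m (suc m + w) ⟩
      m ℤ.⊖ (suc m + w)          ≡⟨ ℤ.⊖-< (≰⇒> n≰m) ⟩
      ℤ.- (+ (suc m + w ∸ m))    ≡⟨ cong (λ x → ℤ.- (+ (x ∸ m))) (sym (+-suc m w)) ⟩
      ℤ.- (+ (m + suc w ∸ m)) ≡⟨ cong (λ x → ℤ.- (+ x)) (m+n∸m≡n m (suc w)) ⟩
      -[1+ w ]           ∎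

  m%k≡0⇒m≡k : ∀ {m} → 0 < m → m < k + k → m % k ≡ 0 → m ≡ k
  m%k≡0⇒m≡k {m} 0<m m<2k m%k≡0 = begin
    m                  ≡⟨ m≡m%n+[m/n]*n m k ⟩
    m % k + m / k * k  ≡⟨ cong₂ (λ r q → r + q * k) m%k≡0 (k≤m<2k⇒m/k≡1 k≤m m<2k) ⟩
    0 + 1 * k          ≡⟨ *-identityˡ k ⟩
    k                  ∎
    where
    open ≡-Reasoning
    k≤m : k ≤ m
    k≤m = ≮⇒≥ (λ m<k → <⇒≢ 0<m (sym (trans (sym (m<n⇒m%n≡m m<k)) m%k≡0)))

inRange? : ∀ sb x → Dec ((1 ≤ x) × (x < sb))
inRange? sb x = (1 ≤? x) ×-dec (x <? sb)

countIn-∷ : ∀ sb x xs → countIn sb (x ∷ xs) ≡ countIn sb [ x ] + countIn sb xs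
countIn-∷ sb x xs = trans (cong length (filter-++ (inRange? sb) [ x ] xs)) (length-++ (filter (inRange? sb) [ x ]))

-- k = k' + 1 and s̄ = s' + 1, so 0 < s̄ < k; adding c = k − s̄ subtracts s̄ modulo k.
module Counting (k' s' : ℕ) (s'<k' : s' < k') where

  k sb c : ℕ
  k = suc k'
  sb = suc s'
  c = k' ∸ s'

  sb+c≡k : sb + c ≡ k
  sb+c≡k = cong suc (m+[n∸m]≡n (<⇒≤ s'<k'))

  c<k : c < k
  c<k = s≤s (m∸n≤m k' s')

  sb%k≡sb : sb % k ≡ sb
  sb%k≡sb = m<n⇒m%n≡m (s≤s s'<k')

  orbit : ℕ → ℕ → List ℕ
  orbit i zero    = []
  orbit i (suc n) = i % k ∷ orbit (i + sb) n

  tupleI≡orbit : ∀ n i → tupleI k sb n i ≡ orbit i n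
  tupleI≡orbit n i = trans (map-upTo _ n) (applyUpTo≡orbit n i (λ j → refl))
    where
    applyUpTo≡orbit : ∀ n i {f} → (∀ j → f j ≡ (i + sb * j) % k) → applyUpTo f n ≡ orbit i n
    applyUpTo≡orbit zero    i f≗ = refl
    applyUpTo≡orbit (suc n) i f≗ = cong₂ _∷_
      (trans (f≗ 0) (%-congˡ (trans (cong (λ y → i + y) (*-zeroʳ sb)) (+-identityʳ i))))
      (applyUpTo≡orbit n (i + sb) (λ j → trans (f≗ (suc j)) (%-congˡ (step j))))
      where
      step : ∀ j → i + sb * suc j ≡ i + sb + sb * j
      step j = trans (cong (λ y → i + y) (*-suc sb j)) (sym (+-assoc i sb (sb * j)))

  countIn-positive-digit : ∀ e → suc e < k → countIn sb [ suc e ] + (suc e + c) / k ≡ 1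
  countIn-positive-digit e e<k with suc e <? sb
  ... | yes e<sb = cong₂ _+_ (cong length (filter-accept (inRange? sb) (s≤s z≤n , e<sb)))
                             (m<n⇒m/n≡0 (subst (suc e + c <_) sb+c≡k (+-monoˡ-< c e<sb)))
  ... | no e≮sb = cong₂ _+_ (cong length (filter-reject (inRange? sb) (λ p → e≮sb (proj₂ p))))
                            (k≤m<2k⇒m/k≡1 k (subst (_≤ suc e + c) sb+c≡k (+-monoˡ-≤ c (≮⇒≥ e≮sb)))
                                            (+-mono-< e<k c<k))

  countIn-digit : ∀ e → e < k → countIn sb [ e ] + (e + c) / k ≡ (e + k') / k
  countIn-digit zero    _   = trans (m<n⇒m/n≡0 c<k) (sym (m<n⇒m/n≡0 (n<1+n k')))
  countIn-digit (suc e) e<k = trans (countIn-positive-digit e e<k)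
                                    (sym (k≤m<2k⇒m/k≡1 k (s≤s (m≤n+m k' e)) (+-mono-< e<k (n<1+n k'))))

  countIn-residue : ∀ y → countIn sb [ y % k ] + (y + c) / k ≡ (y + k') / k
  countIn-residue y = begin
    countIn sb [ y % k ] + (y + c) / k                ≡⟨ cong (λ q → countIn sb [ y % k ] + q) (/-split k y c) ⟩
    countIn sb [ y % k ] + (y / k + (y % k + c) / k)  ≡⟨ swap (countIn sb [ y % k ]) (y / k) _ ⟩
    y / k + (countIn sb [ y % k ] + (y % k + c) / k)  ≡⟨ cong (λ q → y / k + q) (countIn-digit (y % k) (m%n<n y k)) ⟩
    y / k + (y % k + k') / k                          ≡⟨ /-split k y k' ⟨
    (y + k') / k                                      ∎
    where
    open ≡-Reasoning
    swap : ∀ a b c → a + (b + c) ≡ b + (a + c)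
    swap = solve-∀

  [y+k']/k≡[y+k]/k : ∀ y → y % k ≢ 0 → (y + k') / k ≡ (y + k) / k
  [y+k']/k≡[y+k]/k y y%k≢0 = begin
    (y + k') / k              ≡⟨ /-split k y k' ⟩
    y / k + (y % k + k') / k  ≡⟨ cong (λ q → y / k + q) (k≤m<2k⇒m/k≡1 k k≤r+k' (+-mono-< (m%n<n y k) (n<1+n k'))) ⟩
    y / k + 1                 ≡⟨ cong (λ q → y / k + q) (k≤m<2k⇒m/k≡1 k (m≤n+m k (y % k)) (+-monoˡ-< k (m%n<n y k))) ⟨
    y / k + (y % k + k) / k   ≡⟨ /-split k y k ⟨
    (y + k) / k               ∎
    where
    open ≡-Reasoning
    k≤r+k' : k ≤ y % k + k'
    k≤r+k' with y % k
    ... | zero  = ⊥-elim (y%k≢0 refl)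
    ... | suc r = s≤s (m≤n+m k' r)

  countIn-orbit : ∀ m i → admissible sb (orbit i (suc m)) →
                  countIn sb (orbit i (suc m)) + (i + c) / k ≡ (i + c + (sb * suc m ∸ 1)) / k
  countIn-orbit zero i _ =
    trans (countIn-residue i) (/-congˡ (trans (cong (λ y → i + y) (sym (m∸n+n≡m (<⇒≤ s'<k')))) (ring i c s')))
    where
    ring : ∀ i c s' → i + (c + s') ≡ i + c + s' * 1
    ring = solve-∀
  countIn-orbit (suc m) i adm = begin
    countIn sb (i % k ∷ rest) + (i + c) / k                ≡⟨ cong (_+ (i + c) / k) (countIn-∷ sb (i % k) rest) ⟩
    countIn sb [ i % k ] + countIn sb rest + (i + c) / k   ≡⟨ swap (countIn sb [ i % k ]) (countIn sb rest) _ ⟩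
    countIn sb rest + (countIn sb [ i % k ] + (i + c) / k) ≡⟨ cong (λ q → countIn sb rest + q) (countIn-residue i) ⟩
    countIn sb rest + (i + k') / k                         ≡⟨ cong (λ q → countIn sb rest + q) ([y+k']/k≡[y+k]/k i i%k≢0) ⟩
    countIn sb rest + (i + k) / k                          ≡⟨ cong (λ y → countIn sb rest + (i + y) / k) sb+c≡k ⟨
    countIn sb rest + (i + (sb + c)) / k                   ≡⟨ cong (λ y → countIn sb rest + y / k) (+-assoc i sb c) ⟨
    countIn sb rest + (i + sb + c) / k                     ≡⟨ countIn-orbit m (i + sb) (λ (p , q) → adm (there p , there q)) ⟩
    (i + sb + c + (sb * suc m ∸ 1)) / k                    ≡⟨ /-congˡ (ring i s' c m) ⟩
    (i + c + (sb * suc (suc m) ∸ 1)) / k                   ∎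
    where
    open ≡-Reasoning
    rest : List ℕ
    rest = orbit (i + sb) (suc m)
    swap : ∀ a b c → a + b + c ≡ b + (a + c)
    swap = solve-∀
    ring : ∀ i s' c m → i + suc s' + c + (m + s' * suc m) ≡ i + c + (suc m + s' * suc (suc m))
    ring = solve-∀
    i%k≢0 : i % k ≢ 0
    i%k≢0 i%k≡0 = adm (here (sym i%k≡0) , there (here (sym next≡sb)))
      where
      next≡sb : (i + sb) % k ≡ sb
      next≡sb = begin
        (i + sb) % k      ≡⟨ [m%k+n]%k≡[m+n]%k k i sb ⟨
        (i % k + sb) % k  ≡⟨ cong (λ r → (r + sb) % k) i%k≡0 ⟩
        sb % k            ≡⟨ sb%k≡sb ⟩
        sb                ∎

  rot : ℕ → ℕ
  rot i = (i + c) % k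

  countIn-tupleI : ∀ n i → admissible sb (tupleI k sb n i) →
                   countIn sb (tupleI k sb n i) ≡ (rot i + (sb * n ∸ 1)) / k
  countIn-tupleI zero i _ = sym (trans (/-congˡ rot+0≡rot) (m<n⇒m/n≡0 (m%n<n (i + c) k)))
    where
    rot+0≡rot : rot i + (sb * 0 ∸ 1) ≡ rot i
    rot+0≡rot = trans (cong (λ x → rot i + (x ∸ 1)) (*-zeroʳ sb)) (+-identityʳ (rot i))
  countIn-tupleI (suc m) i adm = +-cancelʳ-≡ ((i + c) / k) _ _ (begin
    countIn sb (tupleI k sb (suc m) i) + (i + c) / k  ≡⟨ cong (λ t → countIn sb t + (i + c) / k) I≡orbit ⟩
    countIn sb (orbit i (suc m)) + (i + c) / k        ≡⟨ countIn-orbit m i (subst (admissible sb) I≡orbit adm) ⟩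
    (i + c + a) / k                                   ≡⟨ /-split k (i + c) a ⟩
    (i + c) / k + (rot i + a) / k                     ≡⟨ +-comm ((i + c) / k) _ ⟩
    (rot i + a) / k + (i + c) / k                     ∎)
    where
    open ≡-Reasoning
    a : ℕ
    a = sb * suc m ∸ 1
    I≡orbit : tupleI k sb (suc m) i ≡ orbit i (suc m)
    I≡orbit = tupleI≡orbit (suc m) i

  rot-≥ : ∀ {i} → sb ≤ i → i < k → rot i ≡ i ∸ sb
  rot-≥ {i} sb≤i i<k = begin
    (i + c) % k           ≡⟨ %-congˡ (cong (_+ c) (m∸n+n≡m sb≤i)) ⟨
    (i ∸ sb + sb + c) % k ≡⟨ %-congˡ (trans (+-assoc (i ∸ sb) sb c) (cong (λ y → i ∸ sb + y) sb+c≡k)) ⟩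
    (i ∸ sb + k) % k      ≡⟨ [m+n]%n≡m%n (i ∸ sb) k ⟩
    (i ∸ sb) % k          ≡⟨ m<n⇒m%n≡m (≤-<-trans (m∸n≤m i sb) i<k) ⟩
    i ∸ sb                ∎
    where open ≡-Reasoning

  rot-< : ∀ {i} → i < sb → rot i ≡ i + c
  rot-< {i} i<sb = m<n⇒m%n≡m (subst (i + c <_) sb+c≡k (+-monoˡ-< c i<sb))

  rot-inOpen : ∀ z i → i < k → inOpen k z (+ sb) i → rot (z %ℕ k) < rot i
  rot-inOpen z i i<k rewrite sb%k≡sb = λ where
      (inj₁ (_ , L<i , i<sb))       → subst₂ _<_ (sym (rot-< (<-trans L<i i<sb))) (sym (rot-< i<sb)) (+-monoˡ-< c L<i)
      (inj₂ (sb<L , inj₁ L<i))      → subst₂ _<_ (sym (rot-≥ (<⇒≤ sb<L) L<k)) (sym (rot-≥ (<⇒≤ (<-trans sb<L L<i)) i<k))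
                                              (∸-monoˡ-< L<i (<⇒≤ sb<L))
      (inj₂ (sb<L , inj₂ i<sb))     → subst₂ _<_ (sym (rot-≥ (<⇒≤ sb<L) L<k)) (sym (rot-< i<sb))
                                              (<-≤-trans (∸-monoˡ-< L<k (<⇒≤ sb<L)) (m≤n+m c i))
    where
    L<k : z %ℕ k < k
    L<k = n%ℕd<d z k

  rot-inClosed : ∀ z i → i < k → inClosed k (+ sb) z i → rot i ≤ rot (z %ℕ k)
  rot-inClosed z i i<k rewrite sb%k≡sb = λ where
      (inj₁ (sb≤L , sb≤i , i≤L))    → subst₂ _≤_ (sym (rot-≥ sb≤i i<k)) (sym (rot-≥ sb≤L L<k)) (∸-monoˡ-≤ sb i≤L)
      (inj₂ (L<sb , inj₁ sb≤i))     → subst₂ _≤_ (sym (rot-≥ sb≤i i<k)) (sym (rot-< L<sb))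
                                              (≤-trans (<⇒≤ (∸-monoˡ-< i<k sb≤i)) (m≤n+m c _))
      (inj₂ (L<sb , inj₂ i≤L))      → subst₂ _≤_ (sym (rot-< (≤-<-trans i≤L L<sb))) (sym (rot-< L<sb)) (+-monoˡ-≤ c i≤L)
    where
    L<k : z %ℕ k < k
    L<k = n%ℕd<d z k

  lower : ℕ → ℤ
  lower st = + sb ℤ.- + (sb * st)

  rot-lower+suc[carry]≡k : ∀ m → rot (lower (suc m) %ℕ k) + suc ((sb * suc m ∸ 1) % k) ≡ k
  rot-lower+suc[carry]≡k m = m%k≡0⇒m≡k k (≤-trans (s≤s z≤n) (m≤n+m _ (rot L)))
                                         (+-mono-<-≤ (m%n<n (L + c) k) (m%n<n a k)) sum%k≡0
    where
    open ≡-Reasoning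
    L a : ℕ
    L = lower (suc m) %ℕ k
    a = sb * suc m ∸ 1
    ring : ∀ L c a → suc (L + c) + a ≡ c + (L + suc a)
    ring = solve-∀
    sum%k≡0 : (rot L + suc (a % k)) % k ≡ 0
    sum%k≡0 = begin
      ((L + c) % k + suc (a % k)) % k   ≡⟨ [m%k+n]%k≡[m+n]%k k (L + c) _ ⟩
      (L + c + suc (a % k)) % k         ≡⟨ %-congˡ (+-suc (L + c) (a % k)) ⟩
      (suc (L + c) + a % k) % k         ≡⟨ [m+n%k]%k≡[m+n]%k k (suc (L + c)) a ⟩
      (suc (L + c) + a) % k             ≡⟨ %-congˡ (ring L c a) ⟩
      (c + (L + sb * suc m)) % k        ≡⟨ [m+n%k]%k≡[m+n]%k k c _ ⟨
      (c + (L + sb * suc m) % k) % k    ≡⟨ cong (λ x → (c + x) % k) ([[m-n]%ℕk+n]%k≡m%k k sb (sb * suc m)) ⟩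
      (c + sb % k) % k                  ≡⟨ [m+n%k]%k≡[m+n]%k k c sb ⟩
      (c + sb) % k                      ≡⟨ %-congˡ (trans (+-comm c sb) sb+c≡k) ⟩
      k % k                             ≡⟨ n%n≡0 k ⟩
      0                                 ∎

  ceilDiv-suc : ∀ a → ceilDiv (suc a) k ≡ a / k + 1
  ceilDiv-suc a = begin
    (suc a + k') / k          ≡⟨ /-congˡ (+-suc a k') ⟨
    (a + k) / k               ≡⟨ /-split k a k ⟩
    a / k + (a % k + k) / k   ≡⟨ cong (λ q → a / k + q) (k≤m<2k⇒m/k≡1 k (m≤n+m k (a % k)) (+-monoˡ-< k (m%n<n a k))) ⟩
    a / k + 1                 ∎
    where open ≡-Reasoning

  ceilDiv[sb*0]≡0 : ceilDiv (sb * 0) k ≡ 0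
  ceilDiv[sb*0]≡0 = trans (/-congˡ (cong (_+ k') (*-zeroʳ sb))) (m<n⇒m/n≡0 (n<1+n k'))

  countIn-tupleI-carry : ∀ m i → admissible sb (tupleI k sb (suc m) i) →
    countIn sb (tupleI k sb (suc m) i) ≡ (sb * suc m ∸ 1) / k + ((sb * suc m ∸ 1) % k + rot i) / k
  countIn-tupleI-carry m i adm =
    trans (countIn-tupleI (suc m) i adm) (trans (/-congˡ (+-comm (rot i) a)) (/-split k a (rot i)))
    where
    a : ℕ
    a = sb * suc m ∸ 1

  countIn-inOpen : ∀ st i → i < k → admissible sb (tupleI k sb st i) →
                   inOpen k (lower st) (+ sb) i → countIn sb (tupleI k sb st i) ≡ ceilDiv (sb * st) k
  countIn-inOpen zero    i _   _   _  = sym ceilDiv[sb*0]≡0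
  countIn-inOpen (suc m) i i<k adm i∈ = begin-equality
    countIn sb (tupleI k sb (suc m) i)  ≡⟨ countIn-tupleI-carry m i adm ⟩
    a / k + (a % k + rot i) / k         ≡⟨ cong (λ q → a / k + q) (k≤m<2k⇒m/k≡1 k k≤carry+rot (+-mono-< (m%n<n a k) (m%n<n (i + c) k))) ⟩
    a / k + 1                           ≡⟨ ceilDiv-suc a ⟨
    ceilDiv (sb * suc m) k              ∎
    where
    open ≤-Reasoning
    a : ℕ
    a = sb * suc m ∸ 1
    k≤carry+rot : k ≤ a % k + rot i
    k≤carry+rot = begin
      k                                   ≡⟨ rot-lower+suc[carry]≡k m ⟨
      rot (lower (suc m) %ℕ k) + suc (a % k) ≡⟨ +-comm _ (suc (a % k)) ⟩
      suc (a % k) + rot (lower (suc m) %ℕ k) ≡⟨ +-suc (a % k) _ ⟨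
      a % k + suc (rot (lower (suc m) %ℕ k)) ≤⟨ +-monoʳ-≤ (a % k) (rot-inOpen (lower (suc m)) i i<k i∈) ⟩
      a % k + rot i                       ∎

  countIn-inClosed : ∀ st i → i < k → admissible sb (tupleI k sb st i) →
                     inClosed k (+ sb) (lower st) i → countIn sb (tupleI k sb st i) ≡ ceilDiv (sb * st) k ∸ 1
  countIn-inClosed zero    i _   _   _  = sym (cong (_∸ 1) ceilDiv[sb*0]≡0)
  countIn-inClosed (suc m) i i<k adm i∈ = begin-equality
    countIn sb (tupleI k sb (suc m) i)  ≡⟨ countIn-tupleI-carry m i adm ⟩
    a / k + (a % k + rot i) / k         ≡⟨ cong (λ q → a / k + q) (m<n⇒m/n≡0 carry+rot<k) ⟩
    a / k + 0                           ≡⟨ +-identityʳ (a / k) ⟩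
    a / k                               ≡⟨ m+n∸n≡m (a / k) 1 ⟨
    a / k + 1 ∸ 1                       ≡⟨ cong (_∸ 1) (ceilDiv-suc a) ⟨
    ceilDiv (sb * suc m) k ∸ 1          ∎
    where
    open ≤-Reasoning
    a : ℕ
    a = sb * suc m ∸ 1
    carry+rot<k : a % k + rot i < k
    carry+rot<k = begin-strict
      a % k + rot i                          <⟨ +-monoʳ-< (a % k) (s≤s (rot-inClosed (lower (suc m)) i i<k i∈)) ⟩
      a % k + suc (rot (lower (suc m) %ℕ k)) ≡⟨ +-suc (a % k) _ ⟩
      suc (a % k) + rot (lower (suc m) %ℕ k) ≡⟨ +-comm (suc (a % k)) _ ⟩
      rot (lower (suc m) %ℕ k) + suc (a % k) ≡⟨ rot-lower+suc[carry]≡k m ⟩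
      k                                      ∎

  countIn-≤ : ∀ st i → admissible sb (tupleI k sb st i) →
              countIn sb (tupleI k sb st i) ≤ ceilDiv (sb * st ∸ 1) k
  countIn-≤ st i adm = begin
    countIn sb (tupleI k sb st i)  ≡⟨ countIn-tupleI st i adm ⟩
    (rot i + a) / k                ≤⟨ /-monoˡ-≤ k (+-monoˡ-≤ a (≤-pred (m%n<n (i + c) k))) ⟩
    (k' + a) / k                   ≡⟨ /-congˡ (+-comm k' a) ⟩
    (a + k') / k                   ∎
    where
    open ≤-Reasoning
    a : ℕ
    a = sb * st ∸ 1

  rot-s'≡k' : rot s' ≡ k'
  rot-s'≡k' = trans (%-congˡ (trans (+-comm s' c) (m∸n+n≡m (<⇒≤ s'<k')))) (m<n⇒m%n≡m (n<1+n k'))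

  countIn-tupleI-s' : ∀ st → admissible sb (tupleI k sb st s') →
                      countIn sb (tupleI k sb st s') ≡ ceilDiv (sb * st ∸ 1) k
  countIn-tupleI-s' st adm =
    trans (countIn-tupleI st s' adm) (/-congˡ (trans (cong (_+ (sb * st ∸ 1)) rot-s'≡k') (+-comm k' _)))

  admissible-s' : ∀ u st → (sb * u) % k ≡ 1 → st ≤ u % k → admissible sb (tupleI k sb st s')
  admissible-s' u st sbu≡1 st≤u (_ , sb∈I) with ∈-map⁻ (λ j → (s' + sb * j) % k) sb∈I
  ... | j , j∈ , sb≡ = <-irrefl j≡u%k (<-≤-trans (∈-upTo⁻ j∈) st≤u)
    where
    1%k≡1 : 1 % k ≡ 1
    1%k≡1 = m<n⇒m%n≡m (s≤s (≤-trans (s≤s z≤n) s'<k'))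
    sbj≡1 : (sb * j) % k ≡ 1 % k
    sbj≡1 = %-cancelˡ-+ k s' (sb * j) 1 (trans (sym sb≡) (trans (sym sb%k≡sb) (%-congˡ (+-comm 1 s'))))
    j≡u%k : j ≡ u % k
    j≡u%k = sym (trans (%-inverse-unique k sb u j (trans sbu≡1 (sym 1%k≡1)) sbj≡1)
                       (m<n⇒m%n≡m (<-≤-trans (∈-upTo⁻ j∈) (≤-trans st≤u (<⇒≤ (m%n<n u k))))))

stilde≤u%k : ∀ k u d .{{_ : NonZero k}} → stilde k u (suc d) ≤ u % k
stilde≤u%k k u d = subst (stilde k u (suc d) ≤_) (cong (_%ℕ k) (ℤ.*-identityˡ (+ u))) (m⊓n≤m _ _)

lemma3p15 : (s k d : ℕ) .{{_ : NonZero k}} → Coprime s k → 2 ≤ s → 1 ≤ d → d < k →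
    (u : ℕ) → (sbar s k * u) % k ≡ 1 →
    let sb = sbar s k
        st = stilde k u d
        C = ceilDiv (sb * st) k
        lo = + sb ℤ.- + (sb * st)
    in ((i : ℕ) → i < k → admissible sb (tupleI k sb st i) →
          (inOpen k lo (+ sb) i → countIn sb (tupleI k sb st i) ≡ C)
          × (inClosed k (+ sb) lo i → countIn sb (tupleI k sb st i) ≡ C ∸ 1))
       × ((∃[ j ] (j < k × admissible sb (tupleI k sb st j)
                  × countIn sb (tupleI k sb st j) ≡ ceilDiv (sb * st ∸ 1) k))
          × ((j : ℕ) → j < k → admissible sb (tupleI k sb st j) →
               countIn sb (tupleI k sb st j) ≤ ceilDiv (sb * st ∸ 1) k))
lemma3p15 s (suc k') (suc d) _ _ _ _ u sbu≡1 with sbar s (suc k') | m%n<n s (suc k') | sbu≡1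
... | zero   | _          | ()
... | suc s' | s≤s s'<k' | sbu≡1 =
  (λ i i<k adm → countIn-inOpen st i i<k adm , countIn-inClosed st i i<k adm)
  , (s' , <-trans s'<k' (n<1+n k') , adm-s' , countIn-tupleI-s' st adm-s')
  , (λ j _ → countIn-≤ st j)
  where
  open Counting k' s' s'<k'
  st : ℕ
  st = stilde (suc k') u (suc d)
  adm-s' : admissible sb (tupleI k sb st s')
  adm-s' = admissible-s' u st sbu≡1 (stilde≤u%k (suc k') u d)
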